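{- Let $(L,\leq)$ be a finite lattice. There is a bijection between the set of weak factorization systems on $L$ and the cliques of its elevating graph.
   Context: A finite lattice $(L,\leq)$ is viewed as a category with a unique morphism $a\to b$ whenever $a\leq b$. A relation $(a,b)$ lifts on the left $(c,d)$ if whenever $a\leq c$ and $b\leq d$ we have $b\leq c$. A weak factorization system on $L$ is a pair $(\mathcal{L},\mathcal{R})$ of sets of relations such that every relation $a\leq b$ factors as $a\leq x\leq b$ with $(a,x)\in\mathcal{L}$, $(x,b)\in\mathcal{R}$, $\mathcal{L}$ is exactly the set of relations lifting on the left every relation of $\mathcal{R}$, and $\mathcal{R}$ is exactly the set of relations lifted on the left by every relation of $\mathcal{L}$. The elevating graph of $L$ has as vertices the pairs $(a,b)$ with $a<b$, with an edge between $(a,b)$ and $(c,d)$ iff $(a,b)$ lifts on the left $(c,d)$ and $(c,d)$ lifts on the left $(a,b)$. A clique is a complete induced subgraph (including the empty one). -}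

module Defs where

open import Data.Nat using (ℕ)
open import Data.Fin using (Fin)
open import Data.Bool using (Bool; true; false; T)
open import Data.Product using (Σ; ∃; _×_; _,_)
open import Data.Empty using (⊥)
open import Relation.Nullary using (¬_)
open import Relation.Binary.PropositionalEquality using (_≡_; refl; sym; trans)
open import Relation.Binary.Bundles using (Setoid)
open import Function.Bundles using (_⇔_)
import Relation.Binary.Lattice.Structures as LS

-- A finite lattice, presented (up to isomorphism) on the carrier Fin n.
record FiniteLattice : Set where
  field
    n         : ℕ
    le        : Fin n → Fin n → Bool
    _∨_       : Fin n → Fin n → Fin n
    _∧_       : Fin n → Fin n → Fin n
  _≤_ : Fin n → Fin n → Set
  a ≤ b = T (le a b)
  field
    isLattice : LS.IsLattice _≡_ _≤_ _∨_ _∧_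

module _ (𝕃 : FiniteLattice) where
  open FiniteLattice 𝕃

  Carrier : Set
  Carrier = Fin n

  _<_ : Carrier → Carrier → Set
  a < b = a ≤ b × ¬ (a ≡ b)

  LiftsLeft : Carrier → Carrier → Carrier → Carrier → Set
  LiftsLeft a b c d = a ≤ c → b ≤ d → b ≤ c

  -- A set of relations of L: a decidable subset of the pairs (a,b),
  -- containing only pairs with a ≤ b.
  RelSet : Set
  RelSet = Carrier → Carrier → Bool

  _∈_ : Carrier × Carrier → RelSet → Set
  (a , b) ∈ S = S a b ≡ true

  record WFS : Set where
    field
      𝓛 𝓡 : RelSet
      𝓛-rel : ∀ a b → (a , b) ∈ 𝓛 → a ≤ b
      𝓡-rel : ∀ a b → (a , b) ∈ 𝓡 → a ≤ b
      factor : ∀ a b → a ≤ b →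
        Σ Carrier λ x → (a , x) ∈ 𝓛 × (x , b) ∈ 𝓡
      𝓛-exact : ∀ a b → a ≤ b →
        ((a , b) ∈ 𝓛 ⇔ (∀ c d → (c , d) ∈ 𝓡 → LiftsLeft a b c d))
      𝓡-exact : ∀ c d → c ≤ d →
        ((c , d) ∈ 𝓡 ⇔ (∀ a b → (a , b) ∈ 𝓛 → LiftsLeft a b c d))

  WFS-setoid : Setoid _ _
  WFS-setoid = record
    { Carrier = WFS
    ; _≈_ = λ W W′ → (∀ a b → WFS.𝓛 W a b ≡ WFS.𝓛 W′ a b)
                   × (∀ a b → WFS.𝓡 W a b ≡ WFS.𝓡 W′ a b)
    ; isEquivalence = record
      { refl = (λ _ _ → refl) , (λ _ _ → refl)
      ; sym = λ (p , q) → (λ a b → sym (p a b)) , (λ a b → sym (q a b))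
      ; trans = λ (p , q) (p′ , q′) → (λ a b → trans (p a b) (p′ a b))
                                     , (λ a b → trans (q a b) (q′ a b))
      }
    }

  -- Elevating graph: vertices are pairs (a,b) with a < b; (a,b) and (c,d)
  -- are adjacent iff each lifts on the left the other.
  Adjacent : Carrier → Carrier → Carrier → Carrier → Set
  Adjacent a b c d = LiftsLeft a b c d × LiftsLeft c d a b

  record Clique : Set where
    field
      members : RelSet
      vertex  : ∀ a b → (a , b) ∈ members → a < b
      pairwise : ∀ a b c d → (a , b) ∈ members → (c , d) ∈ members →
        ¬ ((a ≡ c) × (b ≡ d)) → Adjacent a b c d

  Clique-setoid : Setoid _ _
  Clique-setoid = record
    { Carrier = Clique
    ; _≈_ = λ C C′ → ∀ a b → Clique.members C a b ≡ Clique.members C′ a b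
    ; isEquivalence = record
      { refl = λ _ _ → refl
      ; sym = λ p a b → sym (p a b)
      ; trans = λ p q a b → trans (p a b) (q a b)
      }
    }

{-# OPTIONS --safe #-}
module Submission where

-- A weak factorisation system (𝓛, 𝓡) is sent to its canonical clique C: the atomic
-- 𝓛-relations (a, b), i.e. b is minimal among targets of non-identity 𝓛-relations out
-- of a, that are lifted on the left by all other atomic ones.  A clique K is sent to the
-- system generated by K, namely (LeftOrth (RightOrth K), RightOrth K).
--
-- Every set S generates a system: factor a ≤ b through a minimal x with a ≤ x and
-- (x, b) ∈ RightOrth S; as right classes are stable under pullback and composition,
-- (a, x) lifts against all of RightOrth S.  A system is generated by its canonical clique
-- because 𝓛 ∩ RightOrth C contains only identities: a non-identity relation in it would
-- contain an atomic relation escaping it, and pushout stability of 𝓛 turns every such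
-- escape into one from a strictly smaller source, which finiteness forbids.  Conversely a
-- clique K is the canonical clique of the system it generates, since adjacency says
-- exactly that each (a, b) ∈ K lies in RightOrth (K without (a, b)).

open import Defs hiding (_<_; LiftsLeft)
open import Level using (Level; 0ℓ; _⊔_)
open import Algebra.Core using (Op₂)
open import Function.Bundles using (Inverse; Equivalence; mk⇔)
open import Data.Bool.Base using (true)
open import Data.Bool.Properties using (T-≡)
open import Data.Empty using (⊥; ⊥-elim)
open import Data.Fin.Base using (Fin)
open import Data.Fin.Induction using (po-wellFounded)
open import Data.Fin.Properties using (all?; any?; _≟_)
open import Data.Product.Base using (∃-syntax; _×_; _,_; proj₁; proj₂; swap)
open import Induction.WellFounded using (WellFounded; Acc; acc)
open import Relation.Nullary using (¬_; Dec; yes; no; does)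
open import Relation.Nullary.Decidable
  using (T?; map′; ¬?; _×-dec_; _→-dec_; dec-true; does-⇔; decidable-stable)
open import Relation.Unary as U using (Pred)
open import Relation.Binary.Core using (Rel; _⇒_; _⇔_)
open import Relation.Binary.Definitions using (Decidable; DecidableEquality)
open import Relation.Binary.Structures using (IsPartialOrder)
open import Relation.Binary.Bundles using (Setoid)
open import Relation.Binary.Lattice.Structures using (IsLattice)
open import Relation.Binary.PropositionalEquality using (_≡_; refl; sym; trans)
import Relation.Binary.Construct.NonStrictToStrict as ToStrict
import Relation.Binary.Reasoning.Setoid as SetoidReasoning

witness : ∀ {p} {P : Set p} (P? : Dec P) → does P? ≡ true → P
witness (yes p) _ = p

module MinimalElements
  {n ℓ} {_≤_ : Rel (Fin n) ℓ}
  (isPartialOrder : IsPartialOrder _≡_ _≤_) (_≤?_ : Decidable _≤_) where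

  open IsPartialOrder isPartialOrder using () renaming (refl to ≤-refl; trans to ≤-trans)
  open ToStrict _≡_ _≤_ public using (_<_)

  <-wellFounded : WellFounded _<_
  <-wellFounded = po-wellFounded isPartialOrder

  Minimal : ∀ {p} → Pred (Fin n) p → Pred (Fin n) (p ⊔ ℓ)
  Minimal P x = P x × (∀ z → P z → z ≤ x → x ≤ z)

  Minimal? : ∀ {p} {P : Pred (Fin n) p} → U.Decidable P → U.Decidable (Minimal P)
  Minimal? P? x = P? x ×-dec all? λ z → P? z →-dec z ≤? x →-dec x ≤? z

  minimal-below : ∀ {p} {P : Pred (Fin n) p} → U.Decidable P →
                  ∀ {b} → P b → ∃[ x ] x ≤ b × Minimal P x
  minimal-below {P = P} P? {b} = descend (<-wellFounded b)
    where
      descend : ∀ {y} → Acc _<_ y → P y → ∃[ x ] x ≤ y × Minimal P x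
      descend {y} (acc smaller) Py with any? (λ z → P? z ×-dec z ≤? y ×-dec ¬? (y ≤? z))
      ... | yes (z , Pz , z≤y , y≰z) =
        let x , x≤z , minimal = descend (smaller (z≤y , λ { refl → y≰z ≤-refl })) Pz
        in x , ≤-trans x≤z z≤y , minimal
      ... | no none = y , ≤-refl , Py , λ z Pz z≤y →
        decidable-stable (y ≤? z) λ y≰z → none (z , Pz , z≤y , y≰z)

module Orthogonality
  {ℓ₀ ℓ₁ ℓ₂} {A : Set ℓ₀} {_≈_ : Rel A ℓ₁} {_≤_ : Rel A ℓ₂} {_∨_ _∧_ : Op₂ A}
  (isLattice : IsLattice _≈_ _≤_ _∨_ _∧_) where

  open IsLattice isLattice
    using (x≤x∨y; y≤x∨y; ∨-least; x∧y≤x; x∧y≤y; ∧-greatest)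
    renaming (refl to ≤-refl; trans to ≤-trans)

  private
    variable
      ℓ : Level
      S S′ : Rel A ℓ
      a b p q x y z u v : A

  LiftsLeft : A → A → A → A → Set ℓ₂
  LiftsLeft a b c d = a ≤ c → b ≤ d → b ≤ c

  RightOrth : Rel A ℓ → Rel A (ℓ₀ ⊔ ℓ ⊔ ℓ₂)
  RightOrth S c d = c ≤ d × (∀ s t → S s t → LiftsLeft s t c d)

  LeftOrth : Rel A ℓ → Rel A (ℓ₀ ⊔ ℓ ⊔ ℓ₂)
  LeftOrth S a b = a ≤ b × (∀ c d → S c d → LiftsLeft a b c d)

  RightOrth-antitone : S ⇒ S′ → RightOrth S′ ⇒ RightOrth S
  RightOrth-antitone S⇒S′ (c≤d , lifts) = c≤d , λ s t st → lifts s t (S⇒S′ st)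

  LeftOrth-antitone : S ⇒ S′ → LeftOrth S′ ⇒ LeftOrth S
  LeftOrth-antitone S⇒S′ (a≤b , lifts) = a≤b , λ c d cd → lifts c d (S⇒S′ cd)

  RightOrth-cong : S ⇔ S′ → RightOrth S ⇔ RightOrth S′
  RightOrth-cong (S⇒S′ , S′⇒S) = RightOrth-antitone S′⇒S , RightOrth-antitone S⇒S′

  LeftOrth-cong : S ⇔ S′ → LeftOrth S ⇔ LeftOrth S′
  LeftOrth-cong (S⇒S′ , S′⇒S) = LeftOrth-antitone S′⇒S , LeftOrth-antitone S⇒S′

  ⊆-LeftOrth-RightOrth : S ⇒ _≤_ → S ⇒ LeftOrth (RightOrth S)
  ⊆-LeftOrth-RightOrth S⇒≤ st = S⇒≤ st , λ c d (_ , lifts) → lifts _ _ st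

  LeftOrth∩⇒≤ : LeftOrth S a b → S a b → b ≤ a
  LeftOrth∩⇒≤ (_ , lifts) ab = lifts _ _ ab ≤-refl ≤-refl

  RightOrth-refl : ∀ b → RightOrth S b b
  RightOrth-refl b = ≤-refl , λ _ _ _ _ t≤b → t≤b

  RightOrth-∘ : RightOrth S x y → RightOrth S y z → RightOrth S x z
  RightOrth-∘ (x≤y , xy) (y≤z , yz) = ≤-trans x≤y y≤z , λ s t st s≤x t≤z →
    xy s t st s≤x (yz s t st (≤-trans s≤x x≤y) t≤z)

  RightOrth-pullback : RightOrth S p q → x ≤ q → RightOrth S (x ∧ p) x
  RightOrth-pullback {p = p} {x = x} (_ , pq) x≤q = x∧y≤x x p , λ s t st s≤x∧p t≤x →
    ∧-greatest t≤x (pq s t st (≤-trans s≤x∧p (x∧y≤y x p)) (≤-trans t≤x x≤q))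

  LeftOrth-pushout : LeftOrth S x y → x ≤ a → LeftOrth S a (a ∨ y)
  LeftOrth-pushout {y = y} {a = a} (_ , xy) x≤a = x≤x∨y a y , λ c d cd a≤c a∨y≤d →
    ∨-least a≤c (xy c d cd (≤-trans x≤a a≤c) (≤-trans (y≤x∨y a y) a∨y≤d))

  _without_ : Rel A ℓ → A × A → Rel A (ℓ₀ ⊔ ℓ)
  (S without (a , b)) s t = S s t × ¬ (s ≡ a × t ≡ b)

  RightOrth-without : DecidableEquality A →
                      RightOrth (S without (a , b)) u v → LiftsLeft a b u v → RightOrth S u v
  RightOrth-without {S = S} {a} {b} {u} {v} _≟_ (u≤v , lifts) ab = u≤v , lifts′
    where
      lifts′ : ∀ s t → S s t → LiftsLeft s t u v
      lifts′ s t st with s ≟ a | t ≟ b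
      ... | yes refl | yes refl = ab
      ... | no s≢a   | _        = lifts s t (st , λ (s≡a , _) → s≢a s≡a)
      ... | _        | no t≢b   = lifts s t (st , λ (_ , t≡b) → t≢b t≡b)

module _ (𝕃 : FiniteLattice) where
  open FiniteLattice 𝕃
  open IsLattice isLattice
    using (isPartialOrder; antisym; x≤x∨y; y≤x∨y; ∨-least; x∧y≤x; x∧y≤y; ∧-greatest)
    renaming (refl to ≤-refl; trans to ≤-trans)

  _≤?_ : Decidable _≤_
  a ≤? b = T? (le a b)

  open MinimalElements isPartialOrder _≤?_
  open Orthogonality isLattice

  private
    variable
      P P′ : Rel (Carrier 𝕃) 0ℓ
      a b c d x z : Carrier 𝕃

    _≈ᵂ_ = Setoid._≈_ (WFS-setoid 𝕃)
    _≈ᶜ_ = Setoid._≈_ (Clique-setoid 𝕃)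

  LiftsLeft? : ∀ a b c d → Dec (LiftsLeft a b c d)
  LiftsLeft? a b c d = a ≤? c →-dec b ≤? d →-dec b ≤? c

  RightOrth? : Decidable P → Decidable (RightOrth P)
  RightOrth? P? c d = c ≤? d ×-dec all? λ s → all? λ t → P? s t →-dec LiftsLeft? s t c d

  LeftOrth? : Decidable P → Decidable (LeftOrth P)
  LeftOrth? P? a b = a ≤? b ×-dec all? λ c → all? λ d → P? c d →-dec LiftsLeft? a b c d

  ⟦_⟧ : RelSet 𝕃 → Rel (Carrier 𝕃) 0ℓ
  ⟦ S ⟧ a b = S a b ≡ true

  -- Built from T? so that decide ⟦ S ⟧? a b reduces to S a b.
  ⟦_⟧? : (S : RelSet 𝕃) → Decidable ⟦ S ⟧
  ⟦ S ⟧? a b = map′ (Equivalence.to T-≡) (Equivalence.from T-≡) (T? (S a b))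

  decide : Decidable P → RelSet 𝕃
  decide P? a b = does (P? a b)

  ⟦decide⟧ : (P? : Decidable P) → ⟦ decide P? ⟧ ⇔ P
  ⟦decide⟧ P? = (λ {a} {b} → witness (P? a b)) , λ {a} {b} → dec-true (P? a b)

  decide-cong : (P? : Decidable P) (P′? : Decidable P′) → P ⇔ P′ →
             ∀ a b → decide P? a b ≡ decide P′? a b
  decide-cong P? P′? (P⇒P′ , P′⇒P) a b = does-⇔ (mk⇔ P⇒P′ P′⇒P) (P? a b) (P′? a b)

  ≗⇒⟦⟧⇔ : {S S′ : RelSet 𝕃} → (∀ a b → S a b ≡ S′ a b) → ⟦ S ⟧ ⇔ ⟦ S′ ⟧
  ≗⇒⟦⟧⇔ S≗S′ = (λ {a} {b} h → trans (sym (S≗S′ a b)) h) , λ {a} {b} h → trans (S≗S′ a b) h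

  factorise : Decidable P → a ≤ b → ∃[ x ] LeftOrth (RightOrth P) a x × RightOrth P x b
  factorise {a = a} {b} P? a≤b =
    let x , _ , (a≤x , xb) , minimal =
          minimal-below (λ z → a ≤? z ×-dec RightOrth? P? z b) (a≤b , RightOrth-refl b)
    in x , (a≤x , λ p q pq a≤p x≤q →
             let x∧p-candidate = ∧-greatest a≤x a≤p , RightOrth-∘ (RightOrth-pullback pq x≤q) xb
             in ≤-trans (minimal (x ∧ p) x∧p-candidate (x∧y≤x x p)) (x∧y≤y x p))
         , xb

  generated : (S : RelSet 𝕃) → ⟦ S ⟧ ⇒ _≤_ → WFS 𝕃
  generated S S⇒≤ = record
    { 𝓛 = decide L?
    ; 𝓡 = decide R?
    ; 𝓛-rel = λ _ _ l → proj₁ (L⁻ l)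
    ; 𝓡-rel = λ _ _ r → proj₁ (R⁻ r)
    ; factor = λ _ _ a≤b → let x , ax , xb = factorise ⟦ S ⟧? a≤b in x , L⁺ ax , R⁺ xb
    ; 𝓛-exact = λ _ _ a≤b → mk⇔ (λ l c d r → proj₂ (L⁻ l) c d (R⁻ r))
                                 (λ lifts → L⁺ (a≤b , λ c d r → lifts c d (R⁺ r)))
    ; 𝓡-exact = λ _ _ c≤d → mk⇔ (λ r a b l → proj₂ (L⁻ l) _ _ (R⁻ r))
                                 (λ lifts → R⁺ (c≤d , λ s t st →
                                   lifts s t (L⁺ (⊆-LeftOrth-RightOrth S⇒≤ st))))
    }
    where
      R? = RightOrth? ⟦ S ⟧?
      L? = LeftOrth? R?
      R⁻ = proj₁ (⟦decide⟧ R?)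
      R⁺ = proj₂ (⟦decide⟧ R?)
      L⁻ = proj₁ (⟦decide⟧ L?)
      L⁺ = proj₂ (⟦decide⟧ L?)

  Atomic : Rel (Carrier 𝕃) 0ℓ → Rel (Carrier 𝕃) 0ℓ
  Atomic L a = Minimal λ z → L a z × ¬ z ≤ a

  Atomic? : Decidable P → Decidable (Atomic P)
  Atomic? P? a = Minimal? λ z → P? a z ×-dec ¬? (z ≤? a)

  Atomic-transport : P ⇔ P′ → Atomic P ⇒ Atomic P′
  Atomic-transport (P⇒P′ , P′⇒P) ((ab , b≰a) , minimal) =
    (P⇒P′ ab , b≰a) , λ z (az , z≰a) → minimal z (P′⇒P az , z≰a)

  CanonicalClique : Rel (Carrier 𝕃) 0ℓ → Rel (Carrier 𝕃) 0ℓ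
  CanonicalClique L a b =
    Atomic L a b × (∀ c d → Atomic L c d → ¬ (c ≡ a × d ≡ b) → LiftsLeft c d a b)

  CanonicalClique? : Decidable P → Decidable (CanonicalClique P)
  CanonicalClique? P? a b = Atomic? P? a b ×-dec all? λ c → all? λ d →
    Atomic? P? c d →-dec ¬? (c ≟ a ×-dec d ≟ b) →-dec LiftsLeft? c d a b

  CanonicalClique-cong : P ⇔ P′ → CanonicalClique P ⇔ CanonicalClique P′
  CanonicalClique-cong P⇔P′ = transport P⇔P′ , transport (swap P⇔P′)
    where
      transport : P ⇔ P′ → CanonicalClique P ⇒ CanonicalClique P′
      transport P⇔P′ (ab , lifted) =
        Atomic-transport P⇔P′ ab , λ c d cd → lifted c d (Atomic-transport (swap P⇔P′) cd)

  cliqueOf : WFS 𝕃 → Clique 𝕃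
  cliqueOf W = record { members = decide C? ; vertex = vertex ; pairwise = pairwise }
    where
      open WFS W
      C? = CanonicalClique? ⟦ 𝓛 ⟧?
      canonical = proj₁ (⟦decide⟧ C?)

      vertex : ∀ a b → ⟦ decide C? ⟧ a b → a ≤ b × ¬ a ≡ b
      vertex a b ab = let ((ab∈𝓛 , b≰a) , _) , _ = canonical ab
                      in 𝓛-rel a b ab∈𝓛 , λ { refl → b≰a ≤-refl }

      pairwise : ∀ a b c d → ⟦ decide C? ⟧ a b → ⟦ decide C? ⟧ c d →
                 ¬ (a ≡ c × b ≡ d) → LiftsLeft a b c d × LiftsLeft c d a b
      pairwise a b c d ab cd ≢ =
          proj₂ (canonical cd) a b (proj₁ (canonical ab)) ≢
        , proj₂ (canonical ab) c d (proj₁ (canonical cd)) λ (c≡a , d≡b) → ≢ (sym c≡a , sym d≡b)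

  module _ (W : WFS 𝕃) where
    open WFS W

    private
      L = ⟦ 𝓛 ⟧
      R = ⟦ 𝓡 ⟧
      C = ⟦ Clique.members (cliqueOf W) ⟧
      C⇔ = ⟦decide⟧ (CanonicalClique? ⟦ 𝓛 ⟧?)

    𝓛⇔LeftOrth𝓡 : L ⇔ LeftOrth R
    𝓛⇔LeftOrth𝓡 = (λ {a} {b} l → 𝓛-rel a b l , Equivalence.to (𝓛-exact a b (𝓛-rel a b l)) l)
                 , λ {a} {b} (a≤b , lifts) → Equivalence.from (𝓛-exact a b a≤b) lifts

    𝓡⇔RightOrth𝓛 : R ⇔ RightOrth L
    𝓡⇔RightOrth𝓛 = (λ {c} {d} r → 𝓡-rel c d r , Equivalence.to (𝓡-exact c d (𝓡-rel c d r)) r)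
                  , λ {c} {d} (c≤d , lifts) → Equivalence.from (𝓡-exact c d c≤d) lifts

    𝓛-pushout : L x b → x ≤ a → L a (a ∨ b)
    𝓛-pushout xb x≤a = proj₂ 𝓛⇔LeftOrth𝓡 (LeftOrth-pushout (proj₁ 𝓛⇔LeftOrth𝓡 xb) x≤a)

    clique⇒𝓛 : C ⇒ L
    clique⇒𝓛 cd = proj₁ (proj₁ (proj₁ (proj₁ C⇔ cd)))

    atomic-below-∨ : ∀ {c′ d′} → Atomic L c d → L c′ d′ → c′ ≤ c → d′ ≤ d → ¬ d′ ≤ c → d ≤ (c ∨ d′)
    atomic-below-∨ {c} {d} {c′} {d′} ((cd , _) , minimal) c′d′ c′≤c d′≤d d′≰c =
      minimal (c ∨ d′) (𝓛-pushout c′d′ c′≤c , λ c∨d′≤c → d′≰c (≤-trans (y≤x∨y c d′) c∨d′≤c))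
                       (∨-least (𝓛-rel c d cd) d′≤d)

    no-escaping-atomic : RightOrth C x b → Acc _<_ c → Atomic L c d → c ≤ x → d ≤ b → ¬ d ≤ x → ⊥
    no-escaping-atomic {x} {b} {c} {d} xb (acc smaller) cd c≤x d≤b d≰x =
      d≰x (proj₂ xb c d (proj₂ C⇔ (cd , lifted)) c≤x d≤b)
      where
        -- An atomic (c′, d′) failing to lift against (c, d) has d ≤ c ∨ d′, so it either
        -- coincides with (c, d), or forces d ≤ x, or escapes x from the smaller source c′.
        lifted : ∀ c′ d′ → Atomic L c′ d′ → ¬ (c′ ≡ c × d′ ≡ d) → LiftsLeft c′ d′ c d
        lifted c′ d′ c′d′ ≢ c′≤c d′≤d =
          decidable-stable (d′ ≤? c) λ d′≰c → impossible (atomic-below-∨ cd c′d′∈𝓛 c′≤c d′≤d d′≰c)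
                                                          (c ≤? c′) (d′ ≤? x)
          where
            c′d′∈𝓛 = proj₁ (proj₁ c′d′)
            impossible : d ≤ (c ∨ d′) → Dec (c ≤ c′) → Dec (d′ ≤ x) → ⊥
            impossible d≤c∨d′ (yes c≤c′) _ =
              ≢ (antisym c′≤c c≤c′ ,
                 antisym d′≤d (≤-trans d≤c∨d′ (∨-least (≤-trans c≤c′ (𝓛-rel c′ d′ c′d′∈𝓛)) ≤-refl)))
            impossible d≤c∨d′ (no _) (yes d′≤x) = d≰x (≤-trans d≤c∨d′ (∨-least c≤x d′≤x))
            impossible _ (no c≰c′) (no d′≰x) =
              no-escaping-atomic xb (smaller (c′≤c , λ { refl → c≰c′ ≤-refl })) c′d′
                (≤-trans c′≤c c≤x) (≤-trans d′≤d d≤b) d′≰x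

    𝓛∩RightOrthClique⇒≤ : L x b → RightOrth C x b → b ≤ x
    𝓛∩RightOrthClique⇒≤ {x} {b} xb orth = decidable-stable (b ≤? x) λ b≰x →
      let y , y≤b , xy = minimal-below (λ z → ⟦ 𝓛 ⟧? x z ×-dec ¬? (z ≤? x)) (xb , b≰x)
      in no-escaping-atomic orth (<-wellFounded x) xy ≤-refl y≤b (proj₂ (proj₁ xy))

    RightOrthClique⇒𝓡 : RightOrth C ⇒ R
    RightOrthClique⇒𝓡 {a} {b} (a≤b , lifts) = proj₂ 𝓡⇔RightOrth𝓛 (a≤b , λ x y xy x≤a y≤b →
      ≤-trans (y≤x∨y a y) (𝓛∩RightOrthClique⇒≤ (𝓛-pushout xy x≤a)
        (x≤x∨y a y , λ c d cd c≤a d≤a∨y → lifts c d cd c≤a (≤-trans d≤a∨y (∨-least a≤b y≤b)))))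

    𝓡⇔RightOrthClique : R ⇔ RightOrth C
    𝓡⇔RightOrthClique =
      (λ r → RightOrth-antitone clique⇒𝓛 (proj₁ 𝓡⇔RightOrth𝓛 r)) , RightOrthClique⇒𝓡

    𝓛⇔LeftOrthRightOrthClique : L ⇔ LeftOrth (RightOrth C)
    𝓛⇔LeftOrthRightOrthClique =
      (λ l → LeftOrth-antitone (proj₂ 𝓡⇔RightOrthClique) (proj₁ 𝓛⇔LeftOrth𝓡 l)) ,
      (λ l → proj₂ 𝓛⇔LeftOrth𝓡 (LeftOrth-antitone (proj₁ 𝓡⇔RightOrthClique) l))

  module _ (K : Clique 𝕃) where
    open Clique K

    private
      S = ⟦ members ⟧
      R = RightOrth S
      L = LeftOrth R

    member⇒≤ : S ⇒ _≤_
    member⇒≤ {a} {b} ab = proj₁ (vertex a b ab)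

    member-RightOrth-others : S a b → RightOrth (S without (a , b)) a b
    member-RightOrth-others {a} {b} ab =
      member⇒≤ ab , λ s t (st , ≢) → proj₁ (pairwise s t a b st ab ≢)

    left-short-of-member⇒≤ : S a b → L c z → c ≤ a → z ≤ b → ¬ b ≤ z → z ≤ a
    left-short-of-member⇒≤ {a} {b} {c} {z} ab (c≤z , lifts) c≤a z≤b b≰z =
      ≤-trans (lifts (z ∧ a) z pulled (∧-greatest c≤z c≤a) ≤-refl) (x∧y≤y z a)
      where
        pulled : R (z ∧ a) z
        pulled = RightOrth-without _≟_ (RightOrth-pullback (member-RightOrth-others ab) z≤b)
                   λ _ b≤z → ⊥-elim (b≰z b≤z)

    left-into-member⇒left-into-source : S a b → L c b → c ≤ a → L c a
    left-into-member⇒left-into-source {a} {b} {c} ab (_ , lifts) c≤a = c≤a , λ p q pq c≤p a≤q →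
      decidable-stable (a ≤? p) λ a≰p →
        let pulled : R (a ∧ p) b
            pulled = RightOrth-without _≟_
                       (RightOrth-∘ (RightOrth-antitone proj₁ (RightOrth-pullback pq a≤q))
                                    (member-RightOrth-others ab))
                       λ a≤a∧p _ → ⊥-elim (a≰p (≤-trans a≤a∧p (x∧y≤y a p)))
        in a≰p (≤-trans (member⇒≤ ab)
                 (≤-trans (lifts (a ∧ p) b pulled (∧-greatest c≤a c≤p) ≤-refl) (x∧y≤y a p)))

    atomic-lifts-member : S a b → Atomic L c d → ¬ (c ≡ a × d ≡ b) → LiftsLeft c d a b
    atomic-lifts-member {a} {b} {c} {d} ab ((cd , _) , minimal) ≢ c≤a d≤b with d ≟ b
    ... | no d≢b = left-short-of-member⇒≤ ab cd c≤a d≤b λ b≤d → d≢b (antisym d≤b b≤d)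
    ... | yes refl = minimal a (ca , λ a≤c → ≢ (antisym c≤a a≤c , refl)) (member⇒≤ ab)
      where ca = left-into-member⇒left-into-source ab cd c≤a

    member⇒CanonicalClique : S ⇒ CanonicalClique L
    member⇒CanonicalClique {a} {b} ab =
      ((⊆-LeftOrth-RightOrth member⇒≤ ab , b≰a) , minimal) , λ c d → atomic-lifts-member ab
      where
        b≰a : ¬ b ≤ a
        b≰a b≤a = proj₂ (vertex a b ab) (antisym (member⇒≤ ab) b≤a)
        minimal : ∀ z → L a z × ¬ z ≤ a → z ≤ b → b ≤ z
        minimal z (az , z≰a) z≤b =
          decidable-stable (b ≤? z) λ b≰z → z≰a (left-short-of-member⇒≤ ab az ≤-refl z≤b b≰z)

    CanonicalClique⇒member : CanonicalClique L ⇒ S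
    CanonicalClique⇒member {a} {b} (((ab , b≰a) , _) , lifted) =
      decidable-stable (⟦ members ⟧? a b) λ ab∉S →
        b≰a (LeftOrth∩⇒≤ ab (proj₁ ab , λ s t st →
          lifted s t (proj₁ (member⇒CanonicalClique st)) λ { (refl , refl) → ab∉S st }))

  wfsOf : Clique 𝕃 → WFS 𝕃
  wfsOf K = generated (Clique.members K) (member⇒≤ K)

  cliqueOf-wfsOf : ∀ K → cliqueOf (wfsOf K) ≈ᶜ K
  cliqueOf-wfsOf K a b =
    sym (decide-cong ⟦ Clique.members K ⟧? (CanonicalClique? ⟦ WFS.𝓛 (wfsOf K) ⟧?)
                     ( (λ ab → proj₂ canonical⇔ (member⇒CanonicalClique K ab))
                     , (λ ab → CanonicalClique⇒member K (proj₁ canonical⇔ ab)) ) a b)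
    where
      canonical⇔ = CanonicalClique-cong (⟦decide⟧ (LeftOrth? (RightOrth? ⟦ Clique.members K ⟧?)))

  wfsOf-cliqueOf : ∀ W → wfsOf (cliqueOf W) ≈ᵂ W
  wfsOf-cliqueOf W =
      (λ a b → sym (decide-cong ⟦ 𝓛 ⟧? (LeftOrth? (RightOrth? ⟦ C ⟧?))
                                (𝓛⇔LeftOrthRightOrthClique W) a b))
    , (λ a b → sym (decide-cong ⟦ 𝓡 ⟧? (RightOrth? ⟦ C ⟧?) (𝓡⇔RightOrthClique W) a b))
    where
      open WFS W
      C = Clique.members (cliqueOf W)

  cliqueOf-cong : ∀ {W W′} → W ≈ᵂ W′ → cliqueOf W ≈ᶜ cliqueOf W′
  cliqueOf-cong {W} {W′} (𝓛≗ , _) =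
    decide-cong (CanonicalClique? ⟦ WFS.𝓛 W ⟧?) (CanonicalClique? ⟦ WFS.𝓛 W′ ⟧?)
                (CanonicalClique-cong (≗⇒⟦⟧⇔ 𝓛≗))

  wfsOf-cong : ∀ {K K′} → K ≈ᶜ K′ → wfsOf K ≈ᵂ wfsOf K′
  wfsOf-cong {K} {K′} K≗K′ =
      decide-cong (LeftOrth? (RightOrth? S?)) (LeftOrth? (RightOrth? S′?))
                  (LeftOrth-cong (RightOrth-cong S⇔S′))
    , decide-cong (RightOrth? S?) (RightOrth? S′?) (RightOrth-cong S⇔S′)
    where
      S? = ⟦ Clique.members K ⟧?
      S′? = ⟦ Clique.members K′ ⟧?
      S⇔S′ = ≗⇒⟦⟧⇔ K≗K′

mainTheorem6 : (𝕃 : FiniteLattice) → Inverse (WFS-setoid 𝕃) (Clique-setoid 𝕃)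
mainTheorem6 𝕃 = record
  { to = cliqueOf 𝕃
  ; from = wfsOf 𝕃
  ; to-cong = λ {W} {W′} → cliqueOf-cong 𝕃 {W} {W′}
  ; from-cong = λ {K} {K′} → wfsOf-cong 𝕃 {K} {K′}
  ; inverse = (λ {K} {W} → cliqueOf-inverse {K} {W}) , (λ {W} {K} → wfsOf-inverse {W} {K})
  }
  where
    cliqueOf-inverse : ∀ {K W} → Setoid._≈_ (WFS-setoid 𝕃) W (wfsOf 𝕃 K) →
                       Setoid._≈_ (Clique-setoid 𝕃) (cliqueOf 𝕃 W) K
    cliqueOf-inverse {K} {W} W≈wfsOf-K = begin
      cliqueOf 𝕃 W              ≈⟨ cliqueOf-cong 𝕃 {W} {wfsOf 𝕃 K} W≈wfsOf-K ⟩
      cliqueOf 𝕃 (wfsOf 𝕃 K)    ≈⟨ cliqueOf-wfsOf 𝕃 K ⟩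
      K                         ∎
      where open SetoidReasoning (Clique-setoid 𝕃)

    wfsOf-inverse : ∀ {W K} → Setoid._≈_ (Clique-setoid 𝕃) K (cliqueOf 𝕃 W) →
                    Setoid._≈_ (WFS-setoid 𝕃) (wfsOf 𝕃 K) W
    wfsOf-inverse {W} {K} K≈cliqueOf-W = begin
      wfsOf 𝕃 K                 ≈⟨ wfsOf-cong 𝕃 {K} {cliqueOf 𝕃 W} K≈cliqueOf-W ⟩
      wfsOf 𝕃 (cliqueOf 𝕃 W)    ≈⟨ wfsOf-cliqueOf 𝕃 W ⟩
      W                         ∎
      where open SetoidReasoning (WFS-setoid 𝕃)
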